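{- Let $\pi$ be a set partition with $\mathrm{pm}(\pi)\geq 1$. Then there exists a constant $c_1(\pi)>0$ such that for all positive integers $n$, \[B_n(\pi)\geq c_1(\pi)^n\, n^{n\left(1-\frac{1}{\mathrm{pm}(\pi)}\right)}.\]
   Context: A set partition of $[N]$ is a partition of $[N]$ into nonempty unordered blocks. A set partition $\pi$ of $[N]$ contains a set partition $\pi'$ of $[M]$ if there is $S\subseteq[N]$, $|S|=M$, such that the restriction of $\pi$ to $S$, transported to $[M]$ via the order-preserving bijection $S\to[M]$, equals $\pi'$; otherwise $\pi$ avoids $\pi'$. $B_n(\pi)$ denotes the number of set partitions of $[n]$ avoiding $\pi$. For permutations $\sigma_1,\ldots,\sigma_d$ of $[m]$, $[\sigma_1,\ldots,\sigma_d]$ is the set partition of $[(d+1)m]$ with blocks $T_i=\{i,m+\sigma_1(i),2m+\sigma_2(i),\ldots,dm+\sigma_d(i)\}$, $i\in[m]$ (for $d=0$ this is the partition of $[m]$ into singletons). The permutability $\mathrm{pm}(\pi)$ of a set partition $\pi$ is the minimum $d\ge 0$ such that there exist $m$ and permutations $\sigma_1,\ldots,\sigma_d\in S_m$ with $[\sigma_1,\ldots,\sigma_d]$ containing $\pi$. -}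

module Defs where

open import Data.Nat using (ℕ; zero; suc; _*_; _<_)
open import Data.Fin using (Fin; zero; suc; toℕ; remQuot)
import Data.Fin as F
open import Data.Fin.Permutation using (Permutation′; _⟨$⟩ˡ_)
open import Data.Product using (Σ; ∃; ∃-syntax; _×_; _,_)
open import Function.Bundles using (_⇔_)
open import Relation.Binary.PropositionalEquality using (_≡_)
open import Relation.Nullary using (¬_)

-- A set partition of [N] (elements 0..N-1, i.e. Fin N) is given by a block
-- labelling: i and j lie in the same block iff they have the same label.
-- (Blocks = nonempty fibres of the labelling.)  Two labellings represent
-- the same set partition iff they induce the same "same block" relation.
SetPartition : ℕ → Set
SetPartition N = Fin N → ℕ

_≈ₚ_ : ∀ {N} → SetPartition N → SetPartition N → Set
π ≈ₚ ρ = ∀ i j → (π i ≡ π j) ⇔ (ρ i ≡ ρ j)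

-- π (of [N]) contains π' (of [M]): there is an order-preserving injection
-- f : [M] → [N] (i.e. a subset S of size M with its order-preserving
-- bijection) such that the restriction of π to S, transported to [M],
-- equals π'.
Contains : ∀ {N M} → SetPartition N → SetPartition M → Set
Contains {N} {M} π π' =
  Σ (Fin M → Fin N) λ f →
    (∀ i j → i F.< j → f i F.< f j) ×
    (∀ i j → (π (f i) ≡ π (f j)) ⇔ (π' i ≡ π' j))

Avoids : ∀ {N M} → SetPartition N → SetPartition M → Set
Avoids π π' = ¬ Contains π π'

-- Element with 0-indexed position
-- t*m + r (t ≤ d, r < m) is labelled by the index i of its block T_i:
-- for t = 0 the label is r; for t = s+1 it is σ_{s+1}⁻¹(r), since
-- T_i contains t*m + σ_t(i).
bracket : ∀ {d m} → (Fin d → Permutation′ m) → SetPartition (suc d * m)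
bracket {d} {m} σ k with remQuot {suc d} m k
... | zero  , r = toℕ r
... | suc s , r = toℕ (σ s ⟨$⟩ˡ r)

PermutableWith : ∀ {N} → SetPartition N → ℕ → Set
PermutableWith π d = ∃[ m ] Σ (Fin d → Permutation′ m) λ σ → Contains (bracket σ) π

IsPm : ∀ {N} → SetPartition N → ℕ → Set
IsPm π d = PermutableWith π d × (∀ d' → d' < d → ¬ PermutableWith π d')

-- B_n(π) ≥ k : there are k pairwise distinct set partitions of [n] avoiding π
AtLeastAvoiders : ∀ {N} → ℕ → SetPartition N → ℕ → Set
AtLeastAvoiders n π k =
  Σ (Fin k → SetPartition n) λ g →
    (∀ a → Avoids (g a) π) × (∀ a b → g a ≈ₚ g b → a ≡ b)

module Submission where

-- Write d = d' + 1.  By minimality of d no bracket [σ₁,…,σ_{d'}] contains π,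
-- and since containment is transitive neither does any pattern of such a
-- bracket.  Divide n = r + d·m with r < d.  For a d'-tuple σ of permutations
-- of [m], the partition "r singletons followed by [σ]" of [n] is a pattern of
-- the bracket of σ padded by r fixed points, hence avoids π; and it determines
-- σ, because in [σ] position x of row t+1 shares its block with position
-- σ_t⁻¹(x) of row 0.  Decoding Lehmer codes digit by digit yields
-- k = (m!)^{d'} distinct avoiders.  The estimate mᵐ ≤ 8ᵐ m! (by halving m)
-- then gives nⁿ ≤ (32 d)ⁿ (m!)ᵈ, and raising to the power d' the bound above.

open import Defs
open import Data.Nat using (ℕ; zero; suc; _+_; _*_; _^_; _≤_; _<_; _∸_; _!; z≤n; s≤s)
import Data.Nat.Properties as ℕ
open import Data.Nat.DivMod using (_/_; _%_; m≡m%n+[m/n]*n; m%n<n)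
open import Data.Fin
  using (Fin; zero; suc; toℕ; splitAt; _↑ˡ_; _↑ʳ_; combine; quotient; remainder; punchIn; finToFun; funToFin)
import Data.Fin as F
open import Data.Fin.Properties
  using (toℕ-injective; toℕ-↑ˡ; toℕ-↑ʳ; toℕ<n; splitAt-↑ˡ; splitAt-↑ʳ; splitAt⁻¹-↑ˡ; splitAt⁻¹-↑ʳ;
         remQuot-combine; combine-remQuot; toℕ-combine; combine-monoˡ-<; punchIn-injective;
         funToFin-finToFin; <-cmp)
open import Data.Fin.Permutation using (Permutation′; _⟨$⟩ˡ_; id; insert; lift₀)
open import Data.Product using (∃-syntax; _×_; _,_)
open import Data.Sum using (inj₁; inj₂; [_,_]′)
open import Data.Empty using (⊥-elim)
open import Function using (_∘_)
open import Function.Bundles using (_⇔_; mk⇔; Equivalence)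
open import Function.Construct.Composition using (_⇔-∘_)
open import Function.Construct.Symmetry using (⇔-sym)
open import Relation.Binary.Definitions using (tri<; tri≈; tri>)
open import Relation.Binary.PropositionalEquality
open import Relation.Nullary using (¬_)

StrictlyMonotone : ∀ {A B} → (Fin A → Fin B) → Set
StrictlyMonotone f = ∀ i j → i F.< j → f i F.< f j

contains-trans : ∀ {A B C} {P : SetPartition A} {Q : SetPartition B} {R : SetPartition C} →
  Contains P Q → Contains Q R → Contains P R
contains-trans (f , f-mono , f-same) (g , g-mono , g-same) =
  f ∘ g , (λ i j i<j → f-mono (g i) (g j) (g-mono i j i<j)) , λ i j → g-same i j ⇔-∘ f-same (g i) (g j)

restriction-contained : ∀ {A B} (P : SetPartition A) {Q : SetPartition B} (E : Fin B → Fin A) →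
  StrictlyMonotone E → (∀ i → Q i ≡ P (E i)) → Contains P Q
restriction-contained P E E-mono Q≡PE = E , E-mono , λ i j →
  mk⇔ (λ e → trans (Q≡PE i) (trans e (sym (Q≡PE j))))
      (λ e → trans (sym (Q≡PE i)) (trans e (Q≡PE j)))

bracket-row₀ : ∀ {d m} (σ : Fin d → Permutation′ m) j →
  bracket σ (combine {suc d} {m} zero j) ≡ toℕ j
bracket-row₀ {d} {m} σ j rewrite remQuot-combine {suc d} {m} zero j = refl

bracket-rowₛ : ∀ {d m} (σ : Fin d → Permutation′ m) t x →
  bracket σ (combine {suc d} {m} (suc t) x) ≡ toℕ (σ t ⟨$⟩ˡ x)
bracket-rowₛ {d} {m} σ t x rewrite remQuot-combine {suc d} {m} (suc t) x = refl

-- [σ] determines σ: position (t+1, x) shares its block with (0, σ_t⁻¹(x)).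
bracket-determines : ∀ {d m} (σ σ' : Fin d → Permutation′ m) → bracket σ ≈ₚ bracket σ' →
  ∀ t x → σ t ⟨$⟩ˡ x ≡ σ' t ⟨$⟩ˡ x
bracket-determines {d} {m} σ σ' same t x = toℕ-injective (begin
  toℕ y                        ≡⟨ bracket-row₀ σ' y ⟨
  bracket σ' (row zero y)      ≡⟨ Equivalence.to (same (row (suc t) x) (row zero y)) same-in-σ ⟨
  bracket σ' (row (suc t) x)   ≡⟨ bracket-rowₛ σ' t x ⟩
  toℕ (σ' t ⟨$⟩ˡ x)            ∎)
  where
  open ≡-Reasoning
  y = σ t ⟨$⟩ˡ x
  row : Fin (suc d) → Fin m → Fin (suc d * m)
  row = combine
  same-in-σ : bracket σ (row (suc t) x) ≡ bracket σ (row zero y)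
  same-in-σ = trans (bracket-rowₛ σ t x) (sym (bracket-row₀ σ y))

prepend : ∀ r {A} → SetPartition A → SetPartition (r + A)
prepend r P i = [ toℕ , (λ k → r + P k) ]′ (splitAt r i)

prepend-↑ˡ : ∀ r {A} (P : SetPartition A) j → prepend r P (j ↑ˡ A) ≡ toℕ j
prepend-↑ˡ r {A} P j = cong [ toℕ , (λ k → r + P k) ]′ (splitAt-↑ˡ r j A)

prepend-↑ʳ : ∀ r {A} (P : SetPartition A) k → prepend r P (r ↑ʳ k) ≡ r + P k
prepend-↑ʳ r {A} P k = cong [ toℕ , (λ k → r + P k) ]′ (splitAt-↑ʳ r A k)

prepend-reflects-≈ₚ : ∀ r {A} (P Q : SetPartition A) → prepend r P ≈ₚ prepend r Q → P ≈ₚ Q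
prepend-reflects-≈ₚ r P Q same i j =
  shifted Q ⇔-∘ (same (r ↑ʳ i) (r ↑ʳ j) ⇔-∘ ⇔-sym (shifted P))
  where
  shifted : ∀ R → (prepend r R (r ↑ʳ i) ≡ prepend r R (r ↑ʳ j)) ⇔ (R i ≡ R j)
  shifted R = mk⇔
    (λ e → ℕ.+-cancelˡ-≡ r _ _ (trans (sym (prepend-↑ʳ r R i)) (trans e (prepend-↑ʳ r R j))))
    (λ e → trans (prepend-↑ʳ r R i) (trans (cong (r +_) e) (sym (prepend-↑ʳ r R j))))

pad : ∀ r {m} → Permutation′ m → Permutation′ (r + m)
pad zero    σ = σ
pad (suc r) σ = lift₀ (pad r σ)

pad-↑ʳ : ∀ r {m} (σ : Permutation′ m) x → pad r σ ⟨$⟩ˡ (r ↑ʳ x) ≡ r ↑ʳ (σ ⟨$⟩ˡ x)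
pad-↑ʳ zero    σ x = refl
pad-↑ʳ (suc r) σ x = cong suc (pad-↑ʳ r σ x)

combine-map-< : ∀ {D m M} (f : Fin m → Fin M) → StrictlyMonotone f →
  ∀ t t' x x' → combine {D} t x F.< combine t' x' → combine {D} t (f x) F.< combine t' (f x')
combine-map-< {D} {m} {M} f f-mono t t' x x' lt with <-cmp t t'
... | tri< t<t' _ _ = combine-monoˡ-< (f x) (f x') t<t'
... | tri> _ _ t>t' = ⊥-elim (ℕ.<-asym lt (combine-monoˡ-< x' x t>t'))
... | tri≈ _ refl _ = begin-strict
  toℕ (combine t (f x))     ≡⟨ toℕ-combine t (f x) ⟩
  M * toℕ t + toℕ (f x)     <⟨ ℕ.+-monoʳ-< (M * toℕ t) (f-mono x x' x<x') ⟩
  M * toℕ t + toℕ (f x')    ≡⟨ toℕ-combine t (f x') ⟨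
  toℕ (combine t (f x'))    ∎
  where
  open ℕ.≤-Reasoning
  x<x' : x F.< x'
  x<x' = ℕ.+-cancelˡ-< (m * toℕ t) _ _
    (subst₂ _<_ (toℕ-combine t x) (toℕ-combine t x') lt)

data Position (r D m : ℕ) : Fin (r + D * m) → Set where
  front : ∀ j → Position r D m (j ↑ˡ D * m)
  back  : ∀ (t : Fin D) (x : Fin m) → Position r D m (r ↑ʳ combine t x)

position : ∀ r D m i → Position r D m i
position r D m i with splitAt r i in eq
... | inj₁ j = subst (Position r D m) (splitAt⁻¹-↑ˡ eq) (front j)
... | inj₂ k = subst (Position r D m) (trans (cong (r ↑ʳ_) (combine-remQuot {D} m k)) (splitAt⁻¹-↑ʳ eq))
                 (back (quotient {D} m k) (remainder {D} m k))

-- The embedding of "r singletons followed by [σ]" into [pad r ∘ σ]: the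
-- singletons go to the first r cells of row 0, and cell (t, x) of [σ] to cell
-- (t, r + x).
singleton-cell : ∀ {r} d m → Fin r → Fin (suc d * (r + m))
singleton-cell d m j = combine {suc d} zero (j ↑ˡ m)

shifted-cell : ∀ r {d m} → Fin (suc d * m) → Fin (suc d * (r + m))
shifted-cell r {d} {m} k = combine (quotient {suc d} m k) (r ↑ʳ remainder {suc d} m k)

embed : ∀ r {d m} → Fin (r + suc d * m) → Fin (suc d * (r + m))
embed r {d} {m} i = [ singleton-cell d m , shifted-cell r {d} ]′ (splitAt r i)

embed-front : ∀ r {d m} (j : Fin r) → embed r {d} {m} (j ↑ˡ suc d * m) ≡ singleton-cell d m j
embed-front r {d} {m} j = cong [ singleton-cell d m , shifted-cell r {d} ]′ (splitAt-↑ˡ r j (suc d * m))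

embed-back : ∀ r {d m} (t : Fin (suc d)) (x : Fin m) →
  embed r {d} {m} (r ↑ʳ combine t x) ≡ combine t (r ↑ʳ x)
embed-back r {d} {m} t x = begin
  embed r (r ↑ʳ combine t x)
    ≡⟨ cong [ singleton-cell d m , shifted-cell r {d} ]′ (splitAt-↑ʳ r (suc d * m) (combine t x)) ⟩
  shifted-cell r {d} (combine t x)
    ≡⟨ cong (λ (t , x) → combine {suc d} t (r ↑ʳ x)) (remQuot-combine {suc d} t x) ⟩
  combine t (r ↑ʳ x) ∎
  where open ≡-Reasoning

toℕ-embed-front : ∀ r {d m} (j : Fin r) → toℕ (embed r {d} {m} (j ↑ˡ suc d * m)) ≡ toℕ j
toℕ-embed-front r {d} {m} j = begin
  toℕ (embed r {d} {m} (j ↑ˡ suc d * m))  ≡⟨ cong toℕ (embed-front r j) ⟩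
  toℕ ((j ↑ˡ m) ↑ˡ d * (r + m))           ≡⟨ toℕ-↑ˡ (j ↑ˡ m) (d * (r + m)) ⟩
  toℕ (j ↑ˡ m)                            ≡⟨ toℕ-↑ˡ j m ⟩
  toℕ j                                   ∎
  where open ≡-Reasoning

toℕ-embed-back : ∀ r {d m} (t : Fin (suc d)) (x : Fin m) →
  toℕ (embed r {d} {m} (r ↑ʳ combine t x)) ≡ (r + m) * toℕ t + (r + toℕ x)
toℕ-embed-back r {d} {m} t x = begin
  toℕ (embed r {d} {m} (r ↑ʳ combine t x))  ≡⟨ cong toℕ (embed-back r t x) ⟩
  toℕ (combine t (r ↑ʳ x))                  ≡⟨ toℕ-combine t (r ↑ʳ x) ⟩
  (r + m) * toℕ t + toℕ (r ↑ʳ x)            ≡⟨ cong ((r + m) * toℕ t +_) (toℕ-↑ʳ r x) ⟩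
  (r + m) * toℕ t + (r + toℕ x)             ∎
  where open ≡-Reasoning

↑ʳ-mono : ∀ r {m} → StrictlyMonotone (λ (x : Fin m) → r ↑ʳ x)
↑ʳ-mono r x x' x<x' = subst₂ _<_ (sym (toℕ-↑ʳ r x)) (sym (toℕ-↑ʳ r x')) (ℕ.+-monoʳ-< r x<x')

↑ʳ-reflects-< : ∀ r {m} (x x' : Fin m) → r ↑ʳ x F.< r ↑ʳ x' → x F.< x'
↑ʳ-reflects-< r x x' lt = ℕ.+-cancelˡ-< r _ _ (subst₂ _<_ (toℕ-↑ʳ r x) (toℕ-↑ʳ r x') lt)

-- The embedding is strictly monotone: singletons precede everything, and the
-- copy of [σ] keeps its lexicographic (row, column) order.
embed-mono : ∀ r {d m} → StrictlyMonotone (embed r {d} {m})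
embed-mono r {d} {m} i i' i<i' with position r (suc d) m i | position r (suc d) m i'
... | front j | front j' = begin-strict
  toℕ (embed r (j ↑ˡ _))    ≡⟨ toℕ-embed-front r j ⟩
  toℕ j                     ≡⟨ toℕ-↑ˡ j _ ⟨
  toℕ (j ↑ˡ suc d * m)      <⟨ i<i' ⟩
  toℕ (j' ↑ˡ suc d * m)     ≡⟨ toℕ-↑ˡ j' _ ⟩
  toℕ j'                    ≡⟨ toℕ-embed-front r j' ⟨
  toℕ (embed r (j' ↑ˡ _))   ∎
  where open ℕ.≤-Reasoning
... | front j | back t' x' = begin-strict
  toℕ (embed r (j ↑ˡ _))                ≡⟨ toℕ-embed-front r j ⟩
  toℕ j                                 <⟨ toℕ<n j ⟩
  r                                     ≤⟨ ℕ.m≤m+n r (toℕ x') ⟩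
  r + toℕ x'                            ≤⟨ ℕ.m≤n+m (r + toℕ x') ((r + m) * toℕ t') ⟩
  (r + m) * toℕ t' + (r + toℕ x')       ≡⟨ toℕ-embed-back r t' x' ⟨
  toℕ (embed r (r ↑ʳ combine t' x'))    ∎
  where open ℕ.≤-Reasoning
... | back t x | front j' = ⊥-elim (ℕ.<-asym i<i' (begin-strict
  toℕ (j' ↑ˡ suc d * m)      ≡⟨ toℕ-↑ˡ j' _ ⟩
  toℕ j'                     <⟨ toℕ<n j' ⟩
  r                          ≤⟨ ℕ.m≤m+n r _ ⟩
  r + toℕ (combine t x)      ≡⟨ toℕ-↑ʳ r (combine t x) ⟨
  toℕ (r ↑ʳ combine t x)     ∎))
  where open ℕ.≤-Reasoning
... | back t x | back t' x' = subst₂ F._<_ (sym (embed-back r t x)) (sym (embed-back r t' x'))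
  (combine-map-< (r ↑ʳ_) (↑ʳ-mono r) t t' x x' (↑ʳ-reflects-< r (combine t x) (combine t' x') i<i'))

bracket-pad : ∀ r {d m} (σ : Fin d → Permutation′ m) (t : Fin (suc d)) (x : Fin m) →
  bracket (pad r ∘ σ) (combine t (r ↑ʳ x)) ≡ r + bracket σ (combine t x)
bracket-pad r {d} σ zero x = begin
  bracket (pad r ∘ σ) (combine {suc d} zero (r ↑ʳ x))  ≡⟨ bracket-row₀ (pad r ∘ σ) (r ↑ʳ x) ⟩
  toℕ (r ↑ʳ x)                                         ≡⟨ toℕ-↑ʳ r x ⟩
  r + toℕ x                                            ≡⟨ cong (r +_) (bracket-row₀ σ x) ⟨
  r + bracket σ (combine {suc d} zero x)               ∎
  where open ≡-Reasoning
bracket-pad r {d} σ (suc t) x = begin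
  bracket (pad r ∘ σ) (combine (suc t) (r ↑ʳ x))  ≡⟨ bracket-rowₛ (pad r ∘ σ) t (r ↑ʳ x) ⟩
  toℕ (pad r (σ t) ⟨$⟩ˡ (r ↑ʳ x))                 ≡⟨ cong toℕ (pad-↑ʳ r (σ t) x) ⟩
  toℕ (r ↑ʳ (σ t ⟨$⟩ˡ x))                         ≡⟨ toℕ-↑ʳ r (σ t ⟨$⟩ˡ x) ⟩
  r + toℕ (σ t ⟨$⟩ˡ x)                            ≡⟨ cong (r +_) (bracket-rowₛ σ t x) ⟨
  r + bracket σ (combine (suc t) x)               ∎
  where open ≡-Reasoning

prepend-bracket-pattern : ∀ r {d m} (σ : Fin d → Permutation′ m) →
  Contains (bracket (pad r ∘ σ)) (prepend r (bracket σ))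
prepend-bracket-pattern r {d} {m} σ = restriction-contained (bracket τ) (embed r {d} {m}) (embed-mono r) labels
  where
  τ : Fin d → Permutation′ (r + m)
  τ = pad r ∘ σ
  labels : ∀ i → prepend r (bracket σ) i ≡ bracket τ (embed r {d} {m} i)
  labels i with position r (suc d) m i
  ... | front j = begin
    prepend r (bracket σ) (j ↑ˡ suc d * m)         ≡⟨ prepend-↑ˡ r (bracket σ) j ⟩
    toℕ j                                          ≡⟨ toℕ-↑ˡ j m ⟨
    toℕ (j ↑ˡ m)                                   ≡⟨ bracket-row₀ τ (j ↑ˡ m) ⟨
    bracket τ (singleton-cell d m j)               ≡⟨ cong (bracket τ) (embed-front r j) ⟨
    bracket τ (embed r {d} {m} (j ↑ˡ suc d * m))   ∎
    where open ≡-Reasoning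
  ... | back t x = begin
    prepend r (bracket σ) (r ↑ʳ combine t x)       ≡⟨ prepend-↑ʳ r (bracket σ) (combine t x) ⟩
    r + bracket σ (combine t x)                    ≡⟨ bracket-pad r σ t x ⟨
    bracket τ (combine t (r ↑ʳ x))                 ≡⟨ cong (bracket τ) (embed-back r t x) ⟨
    bracket τ (embed r {d} {m} (r ↑ʳ combine t x)) ∎
    where open ≡-Reasoning

remQuot-injective : ∀ {m} n {a b : Fin (m * n)} →
  quotient {m} n a ≡ quotient {m} n b → remainder {m} n a ≡ remainder {m} n b → a ≡ b
remQuot-injective {m} n {a} {b} q≡ r≡ = begin
  a                                                    ≡⟨ combine-remQuot {m} n a ⟨
  combine (quotient {m} n a) (remainder {m} n a)       ≡⟨ cong₂ combine q≡ r≡ ⟩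
  combine (quotient {m} n b) (remainder {m} n b)       ≡⟨ combine-remQuot {m} n b ⟩
  b                                                    ∎
  where open ≡-Reasoning

-- Lehmer-code decoding: a code a ∈ (m+1)! = (m+1)·m! fixes the preimage of 0
-- (its quotient) and, recursively, a permutation of the remaining m points.
decode : ∀ m → Fin (m !) → Permutation′ m
decode zero    _ = id
decode (suc m) a = insert (quotient {suc m} (m !) a) zero (decode m (remainder {suc m} (m !) a))

decode-injective : ∀ m {a b} → (∀ x → decode m a ⟨$⟩ˡ x ≡ decode m b ⟨$⟩ˡ x) → a ≡ b
decode-injective zero    {zero} {zero} _ = refl
decode-injective (suc m) {a} {b} same = remQuot-injective {suc m} (m !) q≡ (decode-injective m rest≡)
  where
  q≡ : quotient {suc m} (m !) a ≡ quotient {suc m} (m !) b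
  q≡ = same zero
  a' b' : Fin (m !)
  a' = remainder {suc m} (m !) a
  b' = remainder {suc m} (m !) b
  rest≡ : ∀ y → decode m a' ⟨$⟩ˡ y ≡ decode m b' ⟨$⟩ˡ y
  rest≡ y = punchIn-injective (quotient {suc m} (m !) a) _ _
    (trans (same (suc y)) (cong (λ c → punchIn c _) (sym q≡)))

funToFin-cong : ∀ {m n} {f g : Fin m → Fin n} → (∀ t → f t ≡ g t) → funToFin f ≡ funToFin g
funToFin-cong {zero}  _    = refl
funToFin-cong {suc m} f≗g = cong₂ combine (f≗g zero) (funToFin-cong (f≗g ∘ suc))

finToFun-injective : ∀ {m n} {a b : Fin (m ^ n)} →
  (∀ t → finToFun {m} {n} a t ≡ finToFun b t) → a ≡ b
finToFun-injective {m} {n} {a} {b} same = begin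
  a                                  ≡⟨ funToFin-finToFin {n} {m} a ⟨
  funToFin (finToFun {m} {n} a)      ≡⟨ funToFin-cong same ⟩
  funToFin (finToFun {m} {n} b)      ≡⟨ funToFin-finToFin {n} {m} b ⟩
  b                                  ∎
  where open ≡-Reasoning

decode-tuple : ∀ d m → Fin ((m !) ^ d) → Fin d → Permutation′ m
decode-tuple d m a t = decode m (finToFun {m !} {d} a t)

decode-tuple-injective : ∀ d m {a b} →
  (∀ t x → decode-tuple d m a t ⟨$⟩ˡ x ≡ decode-tuple d m b t ⟨$⟩ˡ x) → a ≡ b
decode-tuple-injective d m same = finToFun-injective {m !} {d} (λ t → decode-injective m (same t))

avoiders : ∀ {N} (π : SetPartition N) d → ¬ PermutableWith π d →
  ∀ r m → AtLeastAvoiders (r + suc d * m) π ((m !) ^ d)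
avoiders π d not-permutable r m = partition , avoids , distinct
  where
  σ : Fin ((m !) ^ d) → Fin d → Permutation′ m
  σ = decode-tuple d m
  partition : Fin ((m !) ^ d) → SetPartition (r + suc d * m)
  partition a = prepend r (bracket (σ a))
  avoids : ∀ a → Avoids (partition a) π
  avoids a contains-π = not-permutable (r + m , pad r ∘ σ a ,
    contains-trans {P = bracket (pad r ∘ σ a)} (prepend-bracket-pattern r (σ a)) contains-π)
  distinct : ∀ a b → partition a ≈ₚ partition b → a ≡ b
  distinct a b same = decode-tuple-injective d m
    (bracket-determines (σ a) (σ b) (prepend-reflects-≈ₚ r _ _ same))

module Estimates where

  open import Data.Nat.Properties
  open import Data.Nat.Base using (⌊_/2⌋; ⌈_/2⌉)
  open import Data.Nat.Induction using (<-rec)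
  open import Data.Nat.Tactic.RingSolver using (solve-∀)

  ^-distribʳ-* : ∀ x y n → (x * y) ^ n ≡ x ^ n * y ^ n
  ^-distribʳ-* x y zero    = refl
  ^-distribʳ-* x y (suc n) =
    trans (cong ((x * y) *_) (^-distribʳ-* x y n)) (interchange x y (x ^ n) (y ^ n))
    where
    interchange : ∀ x y u v → x * y * (u * v) ≡ x * u * (y * v)
    interchange = solve-∀

  -- m ≤ 2ᵐ; used to absorb a bounded power m^r into an exponential.
  m≤2^m : ∀ m → m ≤ 2 ^ m
  m≤2^m zero    = z≤n
  m≤2^m (suc m) = begin
    suc m          ≤⟨ +-mono-≤ (m^n>0 2 m) (m≤2^m m) ⟩
    2 ^ m + 2 ^ m  ≡⟨ cong (2 ^ m +_) (sym (+-identityʳ (2 ^ m))) ⟩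
    2 ^ suc m      ∎
    where open ≤-Reasoning

  -- b! · bᵃ ≤ (a + b)!: each of the a factors a+b, …, b+1 is at least b.
  !-*-^-≤ : ∀ a b → b ! * b ^ a ≤ (a + b) !
  !-*-^-≤ zero    b = ≤-reflexive (*-identityʳ (b !))
  !-*-^-≤ (suc a) b = begin
    b ! * (b * b ^ a)        ≡⟨ swap (b !) b (b ^ a) ⟩
    b * (b ! * b ^ a)        ≤⟨ *-mono-≤ (m≤n+m b (suc a)) (!-*-^-≤ a b) ⟩
    suc (a + b) * (a + b) !  ∎
    where
    open ≤-Reasoning
    swap : ∀ x y z → x * (y * z) ≡ y * (x * z)
    swap = solve-∀

  -- The inductive step of mᵐ ≤ 8ᵐ m!: split m = a + b with a ≤ b ≤ 2a.  Then
  -- mᵐ ≤ (2b)ᵐ = 2ᵐ bᵇ bᵃ ≤ 2ᵐ 8ᵇ b! bᵃ ≤ 2^(3a) 8ᵇ (a+b)! = 8ᵐ m!.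
  halving-step : ∀ a b → a ≤ b → b ≤ 2 * a → b ^ b ≤ 8 ^ b * b ! →
    (a + b) ^ (a + b) ≤ 8 ^ (a + b) * (a + b) !
  halving-step a b a≤b b≤2a IH = begin
    m ^ m                          ≤⟨ ^-monoˡ-≤ m m≤2b ⟩
    (2 * b) ^ m                    ≡⟨ ^-distribʳ-* 2 b m ⟩
    2 ^ m * b ^ (a + b)            ≡⟨ cong (λ e → 2 ^ m * b ^ e) (+-comm a b) ⟩
    2 ^ m * b ^ (b + a)            ≡⟨ cong (2 ^ m *_) (^-distribˡ-+-* b b a) ⟩
    2 ^ m * (b ^ b * b ^ a)        ≤⟨ *-mono-≤ 2^m≤8^a (*-monoˡ-≤ (b ^ a) IH) ⟩
    8 ^ a * (8 ^ b * b ! * b ^ a)  ≡⟨ regroup (8 ^ a) (8 ^ b) (b !) (b ^ a) ⟩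
    8 ^ a * 8 ^ b * (b ! * b ^ a)  ≤⟨ *-monoʳ-≤ (8 ^ a * 8 ^ b) (!-*-^-≤ a b) ⟩
    8 ^ a * 8 ^ b * m !            ≡⟨ cong (_* m !) (sym (^-distribˡ-+-* 8 a b)) ⟩
    8 ^ m * m !                    ∎
    where
    open ≤-Reasoning
    m = a + b
    regroup : ∀ x y z w → x * (y * z * w) ≡ x * y * (z * w)
    regroup = solve-∀
    m≤2b : m ≤ 2 * b
    m≤2b = ≤-trans (+-monoˡ-≤ b a≤b) (≤-reflexive (cong (b +_) (sym (+-identityʳ b))))
    2^m≤8^a : 2 ^ m ≤ 8 ^ a
    2^m≤8^a = begin
      2 ^ (a + b)      ≤⟨ ^-monoʳ-≤ 2 (+-monoʳ-≤ a b≤2a) ⟩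
      2 ^ (a + 2 * a)  ≡⟨ cong (2 ^_) (three a) ⟩
      2 ^ (3 * a)      ≡⟨ sym (^-*-assoc 2 3 a) ⟩
      8 ^ a            ∎
      where
      three : ∀ a → a + 2 * a ≡ 3 * a
      three = solve-∀

  -- A crude Stirling bound: mᵐ ≤ 8ᵐ m!, by strong induction halving m.
  mᵐ≤8ᵐm! : ∀ m → m ^ m ≤ 8 ^ m * m !
  mᵐ≤8ᵐm! = <-rec (λ m → m ^ m ≤ 8 ^ m * m !) step
    where
    step : ∀ m → (∀ {k} → k < m → k ^ k ≤ 8 ^ k * k !) → m ^ m ≤ 8 ^ m * m !
    step zero          _  = ≤-refl
    step (suc zero)    _  = s≤s z≤n
    step (suc (suc n)) IH =
      subst (λ m → m ^ m ≤ 8 ^ m * m !) a+b≡m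
        (halving-step a b a≤b b≤2a (IH {b} (⌈n/2⌉<n n)))
      where
      a = ⌊ suc (suc n) /2⌋
      b = ⌈ suc (suc n) /2⌉
      a+b≡m : a + b ≡ suc (suc n)
      a+b≡m = ⌊n/2⌋+⌈n/2⌉≡n (suc (suc n))
      a≤b : a ≤ b
      a≤b = ⌊n/2⌋≤⌈n/2⌉ (suc (suc n))
      b≤2a : b ≤ 2 * a
      b≤2a = begin
        b          ≤⟨ ⌊n/2⌋-mono (n≤1+n (suc (suc (suc n)))) ⟩
        suc a      ≤⟨ +-monoˡ-≤ a (s≤s z≤n) ⟩
        a + a      ≡⟨ cong (a +_) (sym (+-identityʳ a)) ⟩
        2 * a      ∎
        where open ≤-Reasoning

  -- For n = r + m·d with r < d:  nⁿ ≤ (32 d)ⁿ (m!)ᵈ.  If m = 0 then n < d;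
  -- otherwise n ≤ 2dm, so nⁿ ≤ (2d)ⁿ mʳ (mᵐ)ᵈ with mʳ ≤ 2^(mr) ≤ 2ⁿ and
  -- (mᵐ)ᵈ ≤ 8^(md) (m!)ᵈ ≤ 8ⁿ (m!)ᵈ.
  nⁿ≤[32d]ⁿ[m!]ᵈ : ∀ d m r → r < d → let n = r + m * d in
    n ^ n ≤ (d * 32) ^ n * (m !) ^ d
  nⁿ≤[32d]ⁿ[m!]ᵈ d zero r r<d = begin
    (r + 0) ^ (r + 0)          ≤⟨ ^-monoˡ-≤ (r + 0) r+0≤32d ⟩
    (d * 32) ^ (r + 0)         ≡⟨ sym (*-identityʳ _) ⟩
    (d * 32) ^ (r + 0) * 1     ≡⟨ cong ((d * 32) ^ (r + 0) *_) (sym (^-zeroˡ d)) ⟩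
    (d * 32) ^ (r + 0) * 1 ^ d ∎
    where
    open ≤-Reasoning
    r+0≤32d : r + 0 ≤ d * 32
    r+0≤32d = ≤-trans (≤-reflexive (+-identityʳ r)) (≤-trans (<⇒≤ r<d) (m≤m*n d 32))
  nⁿ≤[32d]ⁿ[m!]ᵈ d m@(suc _) r r<d = begin
    n ^ n                                ≤⟨ ^-monoˡ-≤ n n≤d*2*m ⟩
    (d * 2 * m) ^ n                      ≡⟨ ^-distribʳ-* (d * 2) m n ⟩
    (d * 2) ^ n * m ^ (r + m * d)        ≡⟨ cong ((d * 2) ^ n *_) (^-distribˡ-+-* m r (m * d)) ⟩
    (d * 2) ^ n * (m ^ r * m ^ (m * d))  ≤⟨ *-monoʳ-≤ ((d * 2) ^ n) (*-mono-≤ mʳ≤2ⁿ mᵐᵈ≤8ⁿ[m!]ᵈ) ⟩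
    (d * 2) ^ n * (2 ^ n * (8 ^ n * F))  ≡⟨ regroup ((d * 2) ^ n) (2 ^ n) (8 ^ n) F ⟩
    (d * 2) ^ n * 2 ^ n * 8 ^ n * F      ≡⟨ cong (λ x → x * 8 ^ n * F) (sym (^-distribʳ-* (d * 2) 2 n)) ⟩
    (d * 2 * 2) ^ n * 8 ^ n * F          ≡⟨ cong (_* F) (sym (^-distribʳ-* (d * 2 * 2) 8 n)) ⟩
    (d * 2 * 2 * 8) ^ n * F              ≡⟨ cong (λ x → x ^ n * F) (times32 d) ⟩
    (d * 32) ^ n * F                     ∎
    where
    open ≤-Reasoning
    n = r + m * d
    F = (m !) ^ d
    regroup : ∀ x y z w → x * (y * (z * w)) ≡ x * y * z * w
    regroup = solve-∀
    times32 : ∀ d → d * 2 * 2 * 8 ≡ d * 32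
    times32 = solve-∀
    n≤d*2*m : n ≤ d * 2 * m
    n≤d*2*m = begin
      r + m * d      ≤⟨ +-monoˡ-≤ (m * d) (≤-trans (<⇒≤ r<d) (m≤n*m d m)) ⟩
      m * d + m * d  ≡⟨ double m d ⟩
      d * 2 * m      ∎
      where
      double : ∀ m d → m * d + m * d ≡ d * 2 * m
      double = solve-∀
    mʳ≤2ⁿ : m ^ r ≤ 2 ^ n
    mʳ≤2ⁿ = begin
      m ^ r        ≤⟨ ^-monoˡ-≤ r (m≤2^m m) ⟩
      (2 ^ m) ^ r  ≡⟨ ^-*-assoc 2 m r ⟩
      2 ^ (m * r)  ≤⟨ ^-monoʳ-≤ 2 (≤-trans (*-monoʳ-≤ m (<⇒≤ r<d)) (m≤n+m (m * d) r)) ⟩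
      2 ^ n        ∎
    mᵐᵈ≤8ⁿ[m!]ᵈ : m ^ (m * d) ≤ 8 ^ n * F
    mᵐᵈ≤8ⁿ[m!]ᵈ = begin
      m ^ (m * d)        ≡⟨ sym (^-*-assoc m m d) ⟩
      (m ^ m) ^ d        ≤⟨ ^-monoˡ-≤ d (mᵐ≤8ᵐm! m) ⟩
      (8 ^ m * m !) ^ d  ≡⟨ ^-distribʳ-* (8 ^ m) (m !) d ⟩
      (8 ^ m) ^ d * F    ≡⟨ cong (_* F) (^-*-assoc 8 m d) ⟩
      8 ^ (m * d) * F    ≤⟨ *-monoˡ-≤ F (^-monoʳ-≤ 8 (m≤n+m (m * d) r)) ⟩
      8 ^ n * F          ∎

  -- The growth bound of the theorem, with d = d' + 1 and k = (m!)^{d'}: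
  -- n^(n d') = (nⁿ)^{d'} ≤ (32 d)^(n d') (m!)^(d d') ≤ (32 d)^(d n) kᵈ.
  growth-bound : ∀ d' m r → r < suc d' → let d = suc d' ; n = r + m * d in
    n ^ (n * d') ≤ (d * 32) ^ (d * n) * ((m !) ^ d') ^ d
  growth-bound d' m r r<d = begin
    n ^ (n * d')                       ≡⟨ sym (^-*-assoc n n d') ⟩
    (n ^ n) ^ d'                       ≤⟨ ^-monoˡ-≤ d' (nⁿ≤[32d]ⁿ[m!]ᵈ d m r r<d) ⟩
    (Q ^ n * (m !) ^ d) ^ d'           ≡⟨ ^-distribʳ-* (Q ^ n) ((m !) ^ d) d' ⟩
    (Q ^ n) ^ d' * ((m !) ^ d) ^ d'    ≡⟨ cong₂ _*_ (^-*-assoc Q n d') (^-*-assoc (m !) d d') ⟩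
    Q ^ (n * d') * (m !) ^ (d * d')    ≤⟨ *-monoˡ-≤ _ (^-monoʳ-≤ Q nd'≤dn) ⟩
    Q ^ (d * n) * (m !) ^ (d * d')     ≡⟨ cong (λ e → Q ^ (d * n) * (m !) ^ e) (*-comm d d') ⟩
    Q ^ (d * n) * (m !) ^ (d' * d)     ≡⟨ cong (Q ^ (d * n) *_) (sym (^-*-assoc (m !) d' d)) ⟩
    Q ^ (d * n) * ((m !) ^ d') ^ d     ∎
    where
    open ≤-Reasoning
    d = suc d'
    n = r + m * d
    Q = d * 32
    nd'≤dn : n * d' ≤ d * n
    nd'≤dn = ≤-trans (≤-reflexive (*-comm n d')) (m≤n+m (d' * n) n)

open Estimates using (growth-bound)

theorem3p1 : ∀ {N} (π : SetPartition N) (d : ℕ) → IsPm π d → 1 ≤ d →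
    ∃[ p ] ∃[ q ] (1 ≤ p × 1 ≤ q ×
      (∀ n → 1 ≤ n → ∃[ k ] (AtLeastAvoiders n π k ×
        p ^ (d * n) * n ^ (n * (d ∸ 1)) ≤ q ^ (d * n) * k ^ d)))
theorem3p1 π (suc d') (_ , minimal) (s≤s z≤n) = 1 , d * 32 , s≤s z≤n , s≤s z≤n , bound
  where
  d = suc d'
  bound : ∀ n → 1 ≤ n → ∃[ k ] (AtLeastAvoiders n π k ×
    1 ^ (d * n) * n ^ (n * d') ≤ (d * 32) ^ (d * n) * k ^ d)
  bound n _ =
    k , subst (λ x → AtLeastAvoiders x π k) r+dm≡n (avoiders π d' not-permutable r m) , growth
    where
    m = n / d
    r = n % d
    k = (m !) ^ d'
    n≡r+md : n ≡ r + m * d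
    n≡r+md = m≡m%n+[m/n]*n n d
    r+dm≡n : r + d * m ≡ n
    r+dm≡n = sym (trans n≡r+md (cong (r +_) (ℕ.*-comm m d)))
    not-permutable : ¬ PermutableWith π d'
    not-permutable = minimal d' (ℕ.n<1+n d')
    growth : 1 ^ (d * n) * n ^ (n * d') ≤ (d * 32) ^ (d * n) * k ^ d
    growth = ℕ.≤-trans (ℕ.≤-reflexive drop-unit)
      (subst (λ x → x ^ (x * d') ≤ (d * 32) ^ (d * x) * k ^ d) (sym n≡r+md)
        (growth-bound d' m r (m%n<n n d)))
      where
      drop-unit : 1 ^ (d * n) * n ^ (n * d') ≡ n ^ (n * d')
      drop-unit = trans (cong (_* n ^ (n * d')) (ℕ.^-zeroˡ (d * n))) (ℕ.*-identityˡ _)
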